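{- Let $G$ be a graph of order $n$ with maximum degree $\Delta$. If $n$ is even, then $b^A_g(G)\le b^I_g(G)\le b^A_g(G)+4\Delta$. If $n$ is odd, then $b^A_g(G)-2\Delta\le b^I_g(G)\le b^A_g(G)+2\Delta$.
   Context: The balance game on a finite simple graph $G$ is played by two players, Admirable (A) and Impish (I), who alternately select a not-yet-labeled vertex of $G$ until all vertices are labeled; Admirable labels each vertex she selects by $0$ and Impish labels each vertex he selects by $1$. Each edge receives the sum modulo $2$ of the labels of its endpoints. Let $e_0$ and $e_1$ be the numbers of edges labeled $0$ and $1$ at the end; the discrepancy is $d=e_1-e_0$. Admirable tries to minimize $d$ and Impish tries to maximize $d$. $b^A_g(G)$ is the value of $d$ under optimal play of both players when Admirable moves first, and $b^I_g(G)$ is the value under optimal play when Impish moves first. -}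

module Defs where

open import Data.Bool using (Bool; true; false; if_then_else_; _xor_; T)
open import Data.Nat using (ℕ; zero; suc; _<ᵇ_)
open import Data.Fin using (Fin; toℕ; _≟_)
open import Data.List using (List; []; _∷_; map; filter; length; concatMap; foldr; allFin)
open import Data.Maybe using (Maybe; just; nothing; is-nothing; fromMaybe)
open import Data.Integer using (ℤ; +_; -_; _+_; _⊔_; _⊓_; 0ℤ; 1ℤ)
open import Relation.Nullary using (does; ¬_)
open import Relation.Binary.PropositionalEquality using (_≡_)
open import Relation.Nullary.Decidable using (⌊_⌋)

record Graph (n : ℕ) : Set where
  field
    adj     : Fin n → Fin n → Bool
    sym     : ∀ u v → adj u v ≡ adj v u
    irrefl  : ∀ v → adj v v ≡ false
open Graph public

degree : ∀ {n} → Graph n → Fin n → ℕ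
degree G v = length (filter (λ u → T? (adj G v u)) (allFin _))
  where
  open import Relation.Nullary.Decidable.Core using () renaming (T? to T?)

maxDegree : ∀ {n} → Graph n → ℕ
maxDegree {n} G = foldr Data.Nat._⊔_ 0 (map (degree G) (allFin n))

open import Data.Product using (_×_; _,_)

edges : ∀ {n} → Graph n → List (Fin n × Fin n)
edges {n} G =
  concatMap (λ u → map (λ v → (u , v))
                       (filter (λ v → T? ((toℕ u <ᵇ toℕ v) Data.Bool.∧ adj G u v)) (allFin n)))
            (allFin n)
  where
  open import Relation.Nullary.Decidable.Core using () renaming (T? to T?)

-- partial labelings: nothing = not yet labeled; just false = label 0; just true = label 1
Labeling : ℕ → Set
Labeling n = Fin n → Maybe Bool

emptyLabeling : ∀ {n} → Labeling n
emptyLabeling _ = nothing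

setLabel : ∀ {n} → Labeling n → Fin n → Bool → Labeling n
setLabel f v b u = if does (u ≟ v) then just b else f u

unlabeled : ∀ {n} → Labeling n → List (Fin n)
unlabeled {n} f = filter (λ u → T? (is-nothing (f u))) (allFin n)
  where
  open import Relation.Nullary.Decidable.Core using () renaming (T? to T?)

sumℤ : List ℤ → ℤ
sumℤ = foldr _+_ 0ℤ

-- discrepancy e₁ - e₀ of a (complete) labeling: an edge gets label
-- (label u + label v) mod 2, i.e. xor; contributes +1 if 1, -1 if 0.
discrepancy : ∀ {n} → Graph n → Labeling n → ℤ
discrepancy G f = sumℤ (map edgeVal (edges G))
  where
  lab = λ u → fromMaybe false (f u)
  edgeVal : _ → ℤ
  edgeVal (u , v) = if lab u xor lab v then 1ℤ else - 1ℤ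

data Player : Set where
  Admirable Impish : Player

other : Player → Player
other Admirable = Impish
other Impish    = Admirable

labelOf : Player → Bool
labelOf Admirable = false
labelOf Impish    = true

combine : Player → ℤ → ℤ → ℤ
combine Admirable = _⊓_
combine Impish    = _⊔_

optimum : Player → ℤ → List ℤ → ℤ
optimum p d []       = d
optimum p d (x ∷ xs) = foldr (combine p) x xs

-- minimax value of the game from labeling f with player p to move,
-- where k is the number of remaining moves (= number of unlabeled vertices).
gameValue : ∀ {n} → Graph n → ℕ → Player → Labeling n → ℤ
gameValue G zero    p f = discrepancy G f
gameValue G (suc k) p f =
  optimum p (discrepancy G f)
    (map (λ v → gameValue G k (other p) (setLabel f v (labelOf p))) (unlabeled f))

bgA : ∀ {n} → Graph n → ℤ
bgA {n} G = gameValue G n Admirable emptyLabeling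

bgI : ∀ {n} → Graph n → ℤ
bgI {n} G = gameValue G n Impish emptyLabeling

{-# OPTIONS --safe #-}
module Submission where

-- Relabelling one vertex changes the discrepancy by at most 2Δ (the vertex lies on at most Δ
-- edges, each of which changes by 2), hence changes the value of every position by at most 2Δ.
-- The heart of the proof compares a position with the same position in which one free vertex is
-- already labelled by a player q: by a strategy-stealing induction over the game, the pre-labelled
-- position is at least as good for q up to 2Δ, and exactly as good when q makes the last move,
-- since the last free vertex then gets q's label in both games. Impish's first move in the game
-- he starts is such a pre-labelling of the game Admirable starts, so b_g^A ≤ b_g^I + c_I;
-- relabelling that vertex by 0 and pre-labelling for Admirable gives b_g^I ≤ b_g^A + c_A + 2Δ,
-- where c_q is 0 if q makes the last move of the game Admirable starts and 2Δ otherwise; who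
-- that is depends only on the parity of n.

open import Defs hiding (sym)
open import Data.Nat as ℕ using (ℕ; zero; suc; _%_; _<ᵇ_; z≤n; s≤s)
open import Data.Nat.Properties as ℕ using ()
open import Data.Nat.ListAction using (sum)
open import Data.Nat.ListAction.Properties using (sum-++)
open import Data.Integer using (ℤ; +_; _+_; _-_; _*_; _≤_; _⊔_; _⊓_; 0ℤ; 1ℤ; -_; +≤+; -≤+)
open import Data.Integer.Properties as ℤ
  using (⊔-sel; ⊓-sel; i≤i⊔j; i≤j⊔i; i⊓j≤i; i⊓j≤j)
open import Algebra.Properties.Semiring.Sum ℕ.+-*-semiring
  using (sum-syntax; sum-remove; sum-cong-≗; ∑-distrib-+; sum-replicate-zero; *-distribʳ-sum)
  renaming (sum to ∑)
open import Algebra.Properties.CommutativeSemigroup ℕ.+-commutativeSemigroup using (x∙yz≈y∙xz)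
open import Algebra.Properties.CommutativeSemigroup ℤ.+-commutativeSemigroup using (interchange)
open import Data.Bool using (Bool; true; false; T; if_then_else_; _∧_; _xor_)
open import Data.Bool.Properties using (∧-zeroʳ; ∧-identityʳ)
open import Data.Empty using (⊥-elim)
open import Data.Fin using (Fin; zero; suc; toℕ; _≟_; punchIn)
open import Data.Fin.Properties using (punchInᵢ≢i)
open import Data.List using (List; []; _∷_; map; filter; length; concatMap; tabulate; allFin; _++_)
open import Data.List.Properties
  using (foldr-preservesᵇ; foldr-preservesᵒ; map-++; map-cong; map-∘; filter-≐; filter-all; length-tabulate)
open import Data.List.Membership.Propositional using (_∈_)
open import Data.List.Membership.Propositional.Properties
  using (∈-map⁺; ∈-map⁻; ∈-filter⁺; ∈-filter⁻; ∈-allFin)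
open import Data.List.Relation.Unary.All as All using ()
open import Data.List.Relation.Unary.Any as Any using (here; there)
open import Data.Maybe using (just; nothing; is-nothing; fromMaybe)
open import Data.Product using (∃-syntax; _×_; _,_; proj₂)
open import Data.Sum using (_⊎_; inj₁; inj₂)
open import Data.Unit using (tt)
open import Function using (_∘_; case_of_)
open import Relation.Binary.PropositionalEquality
  using (_≡_; _≢_; _≗_; refl; sym; trans; cong; cong₂; subst; module ≡-Reasoning)
open import Relation.Nullary using (does; yes; no)
open import Relation.Nullary.Decidable.Core using (T?)

private variable
  A B : Set
  n : ℕ

-- Optimum of a list of integers

combine-sel : ∀ p (a b : ℤ) → combine p a b ≡ a ⊎ combine p a b ≡ b
combine-sel Admirable = ⊓-sel
combine-sel Impish    = ⊔-sel

optimum-∈ : ∀ p d x (xs : List ℤ) → optimum p d (x ∷ xs) ∈ x ∷ xs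
optimum-∈ p d x xs = foldr-preservesᵇ selected (here refl) (All.tabulate there)
  where
  selected : ∀ {a b} → a ∈ x ∷ xs → b ∈ x ∷ xs → combine p a b ∈ x ∷ xs
  selected {a} {b} a∈ b∈ with combine-sel p a b
  ... | inj₁ eq = subst (_∈ x ∷ xs) (sym eq) a∈
  ... | inj₂ eq = subst (_∈ x ∷ xs) (sym eq) b∈

≤-optimum-Impish : ∀ {d y} {ys : List ℤ} → y ∈ ys → y ≤ optimum Impish d ys
≤-optimum-Impish {y = y} {x ∷ xs} y∈ = foldr-preservesᵒ below-⊔ x xs (split y∈)
  where
  below-⊔ : ∀ a b → y ≤ a ⊎ y ≤ b → y ≤ a ⊔ b
  below-⊔ a b (inj₁ y≤a) = ℤ.≤-trans y≤a (i≤i⊔j a b)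
  below-⊔ a b (inj₂ y≤b) = ℤ.≤-trans y≤b (i≤j⊔i a b)
  split : y ∈ x ∷ xs → y ≤ x ⊎ Any.Any (y ≤_) xs
  split (here y≡x)   = inj₁ (ℤ.≤-reflexive y≡x)
  split (there y∈xs) = inj₂ (Any.map ℤ.≤-reflexive y∈xs)

optimum-Admirable-≤ : ∀ {d y} {ys : List ℤ} → y ∈ ys → optimum Admirable d ys ≤ y
optimum-Admirable-≤ {y = y} {x ∷ xs} y∈ = foldr-preservesᵒ ⊓-below x xs (split y∈)
  where
  ⊓-below : ∀ a b → a ≤ y ⊎ b ≤ y → a ⊓ b ≤ y
  ⊓-below a b (inj₁ a≤y) = ℤ.≤-trans (i⊓j≤i a b) a≤y
  ⊓-below a b (inj₂ b≤y) = ℤ.≤-trans (i⊓j≤j a b) b≤y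
  split : y ∈ x ∷ xs → x ≤ y ⊎ Any.Any (_≤ y) xs
  split (here y≡x)   = inj₁ (ℤ.≤-reflexive (sym y≡x))
  split (there y∈xs) = inj₂ (Any.map (ℤ.≤-reflexive ∘ sym) y∈xs)

optimum-Impish-map-lub : ∀ {d c x₀ xs} (a : A → ℤ) → x₀ ∈ xs → (∀ {x} → x ∈ xs → a x ≤ c) →
  optimum Impish d (map a xs) ≤ c
optimum-Impish-map-lub {d = d} {xs = x ∷ xs} a _ bound
  with ∈-map⁻ a (optimum-∈ Impish d (a x) (map a xs))
... | x′ , x′∈ , opt≡ax′ = ℤ.≤-trans (ℤ.≤-reflexive opt≡ax′) (bound x′∈)

optimum-Impish-map-≤ : ∀ {d d′ c x₀ xs ys} (a : A → ℤ) (b : B → ℤ) → x₀ ∈ xs →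
  (∀ {x} → x ∈ xs → ∃[ y ] y ∈ ys × a x ≤ b y + c) →
  optimum Impish d (map a xs) ≤ optimum Impish d′ (map b ys) + c
optimum-Impish-map-≤ {d = d} {d′} {c} {xs = xs} {ys} a b x₀∈ simulate =
  optimum-Impish-map-lub {d = d} a x₀∈ bound
  where
  bound : ∀ {x} → x ∈ xs → a x ≤ optimum Impish d′ (map b ys) + c
  bound x∈ with simulate x∈
  ... | y , y∈ , ax≤ = ℤ.≤-trans ax≤ (ℤ.+-monoˡ-≤ c (≤-optimum-Impish (∈-map⁺ b y∈)))

optimum-Admirable-map-≤ : ∀ {d d′ c y₀ xs ys} (a : A → ℤ) (b : B → ℤ) → y₀ ∈ ys →
  (∀ {y} → y ∈ ys → ∃[ x ] x ∈ xs × a x ≤ b y + c) →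
  optimum Admirable d (map a xs) ≤ optimum Admirable d′ (map b ys) + c
optimum-Admirable-map-≤ {d = d} {d′} {c} {xs = xs} {y ∷ ys} a b _ simulate
  with ∈-map⁻ b (optimum-∈ Admirable d′ (b y) (map b ys))
... | y′ , y′∈ , opt≡by′ with simulate y′∈
...   | x , x∈ , ax≤ = begin
  optimum Admirable d (map a xs)              ≤⟨ optimum-Admirable-≤ (∈-map⁺ a x∈) ⟩
  a x                                         ≤⟨ ax≤ ⟩
  b y′ + c                                    ≡⟨ cong (_+ c) opt≡by′ ⟨
  optimum Admirable d′ (map b (y ∷ ys)) + c   ∎
  where open ℤ.≤-Reasoning

optimum-map-mono : ∀ p {d d′ c} (a b : A → ℤ) xs → d ≤ d′ + c →
  (∀ {x} → x ∈ xs → a x ≤ b x + c) →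
  optimum p d (map a xs) ≤ optimum p d′ (map b xs) + c
optimum-map-mono p                   a b []       d≤ _   = d≤
optimum-map-mono Impish    {d} {d′} a b (x ∷ xs) _  a≤b =
  optimum-Impish-map-≤ {d = d} {d′} a b (here refl) (λ x∈ → _ , x∈ , a≤b x∈)
optimum-map-mono Admirable {d} {d′} a b (x ∷ xs) _  a≤b =
  optimum-Admirable-map-≤ {d = d} {d′} a b (here refl) (λ x∈ → _ , x∈ , a≤b x∈)

-- Lists and finite sums

length≡1⇒≡[x] : ∀ {xs : List A} {x} → length xs ≡ 1 → x ∈ xs → xs ≡ x ∷ []
length≡1⇒≡[x] {xs = _ ∷ []} _ (here refl) = refl

length≡suc⇒∃∈ : ∀ {xs : List A} {k} → length xs ≡ suc k → ∃[ x ] x ∈ xs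
length≡suc⇒∃∈ {xs = x ∷ _} _ = x , here refl

sum-map-concatMap : ∀ (g : B → ℕ) (F : A → List B) xs →
  sum (map g (concatMap F xs)) ≡ sum (map (λ x → sum (map g (F x))) xs)
sum-map-concatMap g F []       = refl
sum-map-concatMap g F (x ∷ xs) = begin
  sum (map g (F x ++ concatMap F xs))
    ≡⟨ cong sum (map-++ g (F x) (concatMap F xs)) ⟩
  sum (map g (F x) ++ map g (concatMap F xs))
    ≡⟨ sum-++ (map g (F x)) _ ⟩
  sum (map g (F x)) ℕ.+ sum (map g (concatMap F xs))
    ≡⟨ cong (sum (map g (F x)) ℕ.+_) (sum-map-concatMap g F xs) ⟩
  sum (map (λ x → sum (map g (F x))) (x ∷ xs)) ∎
  where open ≡-Reasoning

sum-map-*ˡ : ∀ m (g : A → ℕ) xs → sum (map (λ x → m ℕ.* g x) xs) ≡ m ℕ.* sum (map g xs)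
sum-map-*ˡ m g []       = sym (ℕ.*-zeroʳ m)
sum-map-*ˡ m g (x ∷ xs) =
  trans (cong (m ℕ.* g x ℕ.+_) (sum-map-*ˡ m g xs)) (sym (ℕ.*-distribˡ-+ m (g x) (sum (map g xs))))

sumℤ-map-≤ : ∀ {a b : A → ℤ} {c : A → ℕ} → (∀ x → a x ≤ b x + + c x) →
  ∀ xs → sumℤ (map a xs) ≤ sumℤ (map b xs) + + sum (map c xs)
sumℤ-map-≤ a≤b []       = ℤ.≤-refl
sumℤ-map-≤ {a = a} {b} {c} a≤b (x ∷ xs) = begin
  a x + sumℤ (map a xs)
    ≤⟨ ℤ.+-mono-≤ (a≤b x) (sumℤ-map-≤ a≤b xs) ⟩
  (b x + + c x) + (sumℤ (map b xs) + + sum (map c xs))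
    ≡⟨ interchange (b x) (+ c x) _ _ ⟩
  (b x + sumℤ (map b xs)) + (+ c x + + sum (map c xs))
    ≡⟨ cong (λ t → b x + sumℤ (map b xs) + t) (ℤ.pos-+ (c x) _) ⟨
  (b x + sumℤ (map b xs)) + + (c x ℕ.+ sum (map c xs)) ∎
  where open ℤ.≤-Reasoning

bit : Bool → ℕ
bit b = if b then 1 else 0

length-filter-tabulate : ∀ (P : A → Bool) (h : Fin n → A) →
  length (filter (λ a → T? (P a)) (tabulate h)) ≡ ∑[ i < n ] bit (P (h i))
length-filter-tabulate {n = zero}  P h = refl
length-filter-tabulate {n = suc n} P h with P (h zero)
... | true  = cong suc (length-filter-tabulate P (h ∘ suc))
... | false = length-filter-tabulate P (h ∘ suc)

sum-map-filter-tabulate : ∀ (P : A → Bool) (g : A → ℕ) (h : Fin n → A) →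
  sum (map g (filter (λ a → T? (P a)) (tabulate h))) ≡ ∑[ i < n ] (bit (P (h i)) ℕ.* g (h i))
sum-map-filter-tabulate {n = zero}  P g h = refl
sum-map-filter-tabulate {n = suc n} P g h with P (h zero)
... | true  = cong₂ ℕ._+_ (sym (ℕ.*-identityˡ (g (h zero)))) (sum-map-filter-tabulate P g (h ∘ suc))
... | false = sum-map-filter-tabulate P g (h ∘ suc)

sum-map-tabulate : ∀ (g : A → ℕ) (h : Fin n → A) → sum (map g (tabulate h)) ≡ ∑[ i < n ] g (h i)
sum-map-tabulate {n = zero}  g h = refl
sum-map-tabulate {n = suc n} g h = cong (g (h zero) ℕ.+_) (sum-map-tabulate g (h ∘ suc))

∑-mono-≤ : ∀ {F H : Fin n → ℕ} → (∀ i → F i ℕ.≤ H i) → ∑ F ℕ.≤ ∑ H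
∑-mono-≤ {n = zero}  F≤H = z≤n
∑-mono-≤ {n = suc n} F≤H = ℕ.+-mono-≤ (F≤H zero) (∑-mono-≤ (F≤H ∘ suc))

∑-differ-at : ∀ {F H : Fin n → ℕ} x → (∀ i → i ≢ x → F i ≡ H i) →
  F x ℕ.+ ∑ H ≡ H x ℕ.+ ∑ F
∑-differ-at {suc n} {F} {H} x agree = begin
  F x ℕ.+ ∑ H                              ≡⟨ cong (F x ℕ.+_) (sum-remove {i = x} H) ⟩
  F x ℕ.+ (H x ℕ.+ ∑ (H ∘ punchIn x))      ≡⟨ x∙yz≈y∙xz (F x) (H x) _ ⟩
  H x ℕ.+ (F x ℕ.+ ∑ (H ∘ punchIn x))      ≡⟨ cong (λ s → H x ℕ.+ (F x ℕ.+ s)) (sum-cong-≗ agree-off) ⟩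
  H x ℕ.+ (F x ℕ.+ ∑ (F ∘ punchIn x))      ≡⟨ cong (H x ℕ.+_) (sum-remove {i = x} F) ⟨
  H x ℕ.+ ∑ F                              ∎
  where
  open ≡-Reasoning
  agree-off : H ∘ punchIn x ≗ F ∘ punchIn x
  agree-off j = sym (agree (punchIn x j) (punchInᵢ≢i x j))

∑-single : ∀ {F : Fin n → ℕ} x → (∀ i → i ≢ x → F i ≡ 0) → ∑ F ≡ F x
∑-single {n} {F} x vanish = begin
  ∑ F                    ≡⟨ ∑-differ-at x vanish ⟨
  F x ℕ.+ ∑[ i < n ] 0   ≡⟨ cong (F x ℕ.+_) (sum-replicate-zero n) ⟩
  F x ℕ.+ 0              ≡⟨ ℕ.+-identityʳ (F x) ⟩
  F x                    ∎
  where open ≡-Reasoning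

δ : Fin n → Fin n → ℕ
δ x u = bit (does (u ≟ x))

∑-δ : ∀ (F : Fin n → ℕ) x → ∑[ u < n ] (F u ℕ.* δ x u) ≡ F x
∑-δ F x = trans (∑-single x off-x) at-x
  where
  off-x : ∀ u → u ≢ x → F u ℕ.* δ x u ≡ 0
  off-x u u≢x with u ≟ x
  ... | yes u≡x = ⊥-elim (u≢x u≡x)
  ... | no _    = ℕ.*-zeroʳ (F u)
  at-x : F x ℕ.* δ x x ≡ F x
  at-x with x ≟ x
  ... | yes _   = ℕ.*-identityʳ (F x)
  ... | no x≢x = ⊥-elim (x≢x refl)

-- Edges at a vertex

oriented : Graph n → Fin n → Fin n → Bool
oriented G u v = (toℕ u <ᵇ toℕ v) ∧ adj G u v

<ᵇ-exclusive : ∀ m k → bit (m <ᵇ k) ℕ.+ bit (k <ᵇ m) ℕ.≤ 1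
<ᵇ-exclusive zero    zero    = z≤n
<ᵇ-exclusive zero    (suc k) = ℕ.≤-refl
<ᵇ-exclusive (suc m) zero    = ℕ.≤-refl
<ᵇ-exclusive (suc m) (suc k) = <ᵇ-exclusive m k

oriented-≤-adj : ∀ (G : Graph n) x v →
  bit (oriented G x v) ℕ.+ bit (oriented G v x) ℕ.≤ bit (adj G x v)
oriented-≤-adj G x v rewrite Graph.sym G v x with adj G x v
... | true  rewrite ∧-identityʳ (toℕ x <ᵇ toℕ v) | ∧-identityʳ (toℕ v <ᵇ toℕ x) =
  <ᵇ-exclusive (toℕ x) (toℕ v)
... | false rewrite ∧-zeroʳ (toℕ x <ᵇ toℕ v) | ∧-zeroʳ (toℕ v <ᵇ toℕ x) = z≤n

incidence : Fin n → Fin n × Fin n → ℕ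
incidence x (u , v) = δ x u ℕ.+ δ x v

incidences-≤-degree : ∀ (G : Graph n) x → sum (map (incidence x) (edges G)) ℕ.≤ degree G x
incidences-≤-degree {n} G x = begin
  sum (map (incidence x) (edges G))
    ≡⟨ sum-map-concatMap (incidence x) (λ u → map (u ,_) (successors u)) (allFin n) ⟩
  sum (map (λ u → sum (map (incidence x) (map (u ,_) (successors u)))) (allFin n))
    ≡⟨ cong sum (map-cong fuse (allFin n)) ⟩
  sum (map (λ u → ∑[ v < n ] (arc u v ℕ.* incidence x (u , v))) (allFin n))
    ≡⟨ sum-map-tabulate (λ u → ∑[ v < n ] (arc u v ℕ.* incidence x (u , v))) (λ u → u) ⟩
  ∑[ u < n ] ∑[ v < n ] (arc u v ℕ.* (δ x u ℕ.+ δ x v))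
    ≡⟨ sum-cong-≗ (λ u → trans (sum-cong-≗ (λ v → ℕ.*-distribˡ-+ (arc u v) (δ x u) (δ x v)))
                               (∑-distrib-+ (λ v → arc u v ℕ.* δ x u) (λ v → arc u v ℕ.* δ x v))) ⟩
  ∑[ u < n ] (∑[ v < n ] (arc u v ℕ.* δ x u) ℕ.+ ∑[ v < n ] (arc u v ℕ.* δ x v))
    ≡⟨ ∑-distrib-+ (λ u → ∑[ v < n ] (arc u v ℕ.* δ x u)) (λ u → ∑[ v < n ] (arc u v ℕ.* δ x v)) ⟩
  ∑[ u < n ] ∑[ v < n ] (arc u v ℕ.* δ x u) ℕ.+ ∑[ u < n ] ∑[ v < n ] (arc u v ℕ.* δ x v)
    ≡⟨ cong₂ ℕ._+_ out-of-x into-x ⟩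
  ∑[ v < n ] arc x v ℕ.+ ∑[ v < n ] arc v x
    ≡⟨ ∑-distrib-+ (arc x) (λ v → arc v x) ⟨
  ∑[ v < n ] (arc x v ℕ.+ arc v x)
    ≤⟨ ∑-mono-≤ (oriented-≤-adj G x) ⟩
  ∑[ v < n ] bit (adj G x v)
    ≡⟨ length-filter-tabulate (adj G x) (λ v → v) ⟨
  degree G x ∎
  where
  open ℕ.≤-Reasoning
  successors : Fin n → List (Fin n)
  successors u = filter (λ v → T? (oriented G u v)) (allFin n)
  arc : Fin n → Fin n → ℕ
  arc u v = bit (oriented G u v)
  fuse : ∀ u → sum (map (incidence x) (map (u ,_) (successors u)))
             ≡ ∑[ v < n ] (arc u v ℕ.* incidence x (u , v))
  fuse u = trans (cong sum (sym (map-∘ (successors u))))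
                 (sum-map-filter-tabulate (oriented G u) (incidence x ∘ (u ,_)) (λ v → v))
  out-of-x : ∑[ u < n ] ∑[ v < n ] (arc u v ℕ.* δ x u) ≡ ∑[ v < n ] arc x v
  out-of-x = trans (sum-cong-≗ (λ u → sym (*-distribʳ-sum (δ x u) (arc u))))
                   (∑-δ (λ u → ∑[ v < n ] arc u v) x)
  into-x : ∑[ u < n ] ∑[ v < n ] (arc u v ℕ.* δ x v) ≡ ∑[ u < n ] arc u x
  into-x = sum-cong-≗ (λ u → ∑-δ (arc u) x)

degree-≤-maxDegree : ∀ (G : Graph n) x → degree G x ℕ.≤ maxDegree G
degree-≤-maxDegree {n} G x = foldr-preservesᵒ below-⊔ 0 (map (degree G) (allFin n))
  (inj₂ (Any.map ℕ.≤-reflexive (∈-map⁺ (degree G) (∈-allFin x))))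
  where
  below-⊔ : ∀ a b → degree G x ℕ.≤ a ⊎ degree G x ℕ.≤ b → degree G x ℕ.≤ a ℕ.⊔ b
  below-⊔ a b (inj₁ d≤a) = ℕ.≤-trans d≤a (ℕ.m≤m⊔n a b)
  below-⊔ a b (inj₂ d≤b) = ℕ.≤-trans d≤b (ℕ.m≤n⊔m a b)

-- Labellings

setLabel-same : ∀ (f : Labeling n) v b → setLabel f v b v ≡ just b
setLabel-same f v b with v ≟ v
... | yes _   = refl
... | no v≢v = ⊥-elim (v≢v refl)

setLabel-other : ∀ (f : Labeling n) {u v} b → u ≢ v → setLabel f v b u ≡ f u
setLabel-other f {u} {v} b u≢v with u ≟ v
... | yes u≡v = ⊥-elim (u≢v u≡v)
... | no _    = refl

setLabel-comm : ∀ (f : Labeling n) {u v} b c → u ≢ v →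
  setLabel (setLabel f u b) v c ≗ setLabel (setLabel f v c) u b
setLabel-comm f {u} {v} b c u≢v w with w ≟ v | w ≟ u
... | yes refl | yes refl = ⊥-elim (u≢v refl)
... | yes _    | no _     = refl
... | no _     | yes _    = refl
... | no _     | no _     = refl

setLabel-cong : ∀ {f g : Labeling n} v b → f ≗ g → setLabel f v b ≗ setLabel g v b
setLabel-cong v b f≗g u with u ≟ v
... | yes _ = refl
... | no _  = f≗g u

∈-unlabeled⁺ : ∀ {f : Labeling n} {v} → f v ≡ nothing → v ∈ unlabeled f
∈-unlabeled⁺ {f = f} {v} fv≡nothing =
  ∈-filter⁺ (λ u → T? (is-nothing (f u))) (∈-allFin v) (subst (T ∘ is-nothing) (sym fv≡nothing) tt)

∈-unlabeled⁻ : ∀ {f : Labeling n} {v} → v ∈ unlabeled f → f v ≡ nothing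
∈-unlabeled⁻ {n} {f} {v} v∈
  with f v | proj₂ (∈-filter⁻ (λ u → T? (is-nothing (f u))) {xs = allFin n} v∈)
... | nothing | _ = refl

∈-unlabeled-setLabel⁻ : ∀ {f : Labeling n} {u v b} → u ∈ unlabeled (setLabel f v b) →
  u ≢ v × u ∈ unlabeled f
∈-unlabeled-setLabel⁻ {f = f} {u} {v} {b} u∈ =
  u≢v , ∈-unlabeled⁺ (trans (sym (setLabel-other f b u≢v)) (∈-unlabeled⁻ u∈))
  where
  u≢v : u ≢ v
  u≢v refl with () ← trans (sym (setLabel-same f u b)) (∈-unlabeled⁻ u∈)

∈-unlabeled-setLabel⁺ : ∀ {f : Labeling n} {u v} b → u ≢ v → u ∈ unlabeled f →
  u ∈ unlabeled (setLabel f v b)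
∈-unlabeled-setLabel⁺ {f = f} b u≢v u∈ =
  ∈-unlabeled⁺ (trans (setLabel-other f b u≢v) (∈-unlabeled⁻ u∈))

unlabeled-cong : ∀ {f g : Labeling n} → (∀ u → is-nothing (f u) ≡ is-nothing (g u)) →
  unlabeled f ≡ unlabeled g
unlabeled-cong {n} {f} {g} alike = filter-≐ (λ u → T? (is-nothing (f u))) (λ u → T? (is-nothing (g u)))
  ((λ {u} → subst T (alike u)) , (λ {u} → subst T (sym (alike u)))) (allFin n)

unlabeled-empty : unlabeled (emptyLabeling {n}) ≡ allFin n
unlabeled-empty {n} =
  filter-all (λ u → T? (is-nothing (emptyLabeling {n} u))) (All.universal (λ _ → tt) (allFin n))

length-unlabeled-setLabel : ∀ {f : Labeling n} {v k} b → length (unlabeled f) ≡ suc k → v ∈ unlabeled f →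
  length (unlabeled (setLabel f v b)) ≡ k
length-unlabeled-setLabel {n} {f} {v} b count v∈ = ℕ.suc-injective (trans (sym one-fewer) count)
  where
  open ≡-Reasoning
  free free′ : Fin n → ℕ
  free  i = bit (is-nothing (f i))
  free′ i = bit (is-nothing (setLabel f v b i))
  one-fewer : length (unlabeled f) ≡ suc (length (unlabeled (setLabel f v b)))
  one-fewer = begin
    length (unlabeled f)
      ≡⟨ length-filter-tabulate (is-nothing ∘ f) (λ i → i) ⟩
    ∑ free
      ≡⟨ cong (λ m → bit (is-nothing m) ℕ.+ ∑ free) (setLabel-same f v b) ⟨
    free′ v ℕ.+ ∑ free
      ≡⟨ ∑-differ-at v (λ i i≢v → cong (bit ∘ is-nothing) (sym (setLabel-other f b i≢v))) ⟨
    free v ℕ.+ ∑ free′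
      ≡⟨ cong (λ m → bit (is-nothing m) ℕ.+ ∑ free′) (∈-unlabeled⁻ v∈) ⟩
    suc (∑ free′)
      ≡⟨ cong suc (length-filter-tabulate (is-nothing ∘ setLabel f v b) (λ i → i)) ⟨
    suc (length (unlabeled (setLabel f v b))) ∎

-- If z = y, both sides continue with any other free vertex.
moves-commute : ∀ {f : Labeling n} {y z k} b → length (unlabeled f) ≡ suc (suc k) →
  y ∈ unlabeled f → z ∈ unlabeled f →
  ∃[ y′ ] ∃[ z′ ] y′ ∈ unlabeled (setLabel f z b) × z′ ∈ unlabeled (setLabel f y b)
                × setLabel (setLabel f z b) y′ b ≗ setLabel (setLabel f y b) z′ b
moves-commute {f = f} {y} {z} b count y∈ z∈ with z ≟ y
... | yes refl =
  let v , v∈ = length≡suc⇒∃∈ (length-unlabeled-setLabel b count y∈)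
  in  v , v , v∈ , v∈ , λ _ → refl
... | no z≢y   =
  y , z , ∈-unlabeled-setLabel⁺ b (z≢y ∘ sym) y∈ , ∈-unlabeled-setLabel⁺ b z≢y z∈ ,
  setLabel-comm f b b z≢y

-- Discrepancy

sign : Bool → ℤ
sign b = if b then 1ℤ else - 1ℤ

sign-≤ : ∀ a b {m} → 1 ℕ.≤ m → sign a ≤ sign b + + (2 ℕ.* m)
sign-≤ a b 1≤m = ℤ.≤-trans (sign-≤-1 a) (ℤ.+-mono-≤ (-1-≤-sign b) (+≤+ (ℕ.*-monoʳ-≤ 2 1≤m)))
  where
  sign-≤-1 : ∀ a → sign a ≤ 1ℤ
  sign-≤-1 true  = ℤ.≤-refl
  sign-≤-1 false = -≤+
  -1-≤-sign : ∀ b → - 1ℤ ≤ sign b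
  -1-≤-sign true  = -≤+
  -1-≤-sign false = ℤ.≤-refl

label : Labeling n → Fin n → Bool
label f u = fromMaybe false (f u)

-- Definitionally equal to the summand of discrepancy; the proofs below unfold discrepancy to it.
edgeValue : Labeling n → Fin n × Fin n → ℤ
edgeValue f (u , v) = sign (label f u xor label f v)

discrepancy-cong : ∀ (G : Graph n) {f g} → f ≗ g → discrepancy G f ≡ discrepancy G g
discrepancy-cong G {f} {g} f≗g = cong sumℤ (map-cong edgeValue-cong (edges G))
  where
  edgeValue-cong : edgeValue f ≗ edgeValue g
  edgeValue-cong (u , v) rewrite f≗g u | f≗g v = refl

edgeValue-flip : ∀ {f g : Labeling n} x → (∀ u → u ≢ x → f u ≡ g u) →
  ∀ e → edgeValue f e ≤ edgeValue g e + + (2 ℕ.* incidence x e)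
edgeValue-flip {f = f} {g} x agree (u , v) with u ≟ x | v ≟ x
... | no u≢x | no v≢x rewrite agree u u≢x | agree v v≢x = ℤ.≤-reflexive (sym (ℤ.+-identityʳ _))
... | yes _  | _      = sign-≤ (label f u xor label f v) (label g u xor label g v) (s≤s z≤n)
... | no _   | yes _  = sign-≤ (label f u xor label f v) (label g u xor label g v) ℕ.≤-refl

discrepancy-flip : ∀ (G : Graph n) {f g} x → (∀ u → u ≢ x → f u ≡ g u) →
  discrepancy G f ≤ discrepancy G g + (+ 2) * (+ maxDegree G)
discrepancy-flip G {f} {g} x agree = begin
  discrepancy G f
    ≤⟨ sumℤ-map-≤ (edgeValue-flip x agree) (edges G) ⟩
  discrepancy G g + + sum (map (λ e → 2 ℕ.* incidence x e) (edges G))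
    ≡⟨ cong (λ m → discrepancy G g + + m) (sum-map-*ˡ 2 (incidence x) (edges G)) ⟩
  discrepancy G g + + (2 ℕ.* sum (map (incidence x) (edges G)))
    ≤⟨ ℤ.+-monoʳ-≤ (discrepancy G g) (+≤+ (ℕ.*-monoʳ-≤ 2 incidences-≤-Δ)) ⟩
  discrepancy G g + + (2 ℕ.* maxDegree G)
    ≡⟨ cong (λ t → discrepancy G g + t) (ℤ.pos-* 2 (maxDegree G)) ⟩
  discrepancy G g + (+ 2) * (+ maxDegree G) ∎
  where
  open ℤ.≤-Reasoning
  incidences-≤-Δ : sum (map (incidence x) (edges G)) ℕ.≤ maxDegree G
  incidences-≤-Δ = ℕ.≤-trans (incidences-≤-degree G x) (degree-≤-maxDegree G x)

-- Game values

-- With k + 1 moves left and p to move, mover p k makes the last move.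
mover : Player → ℕ → Player
mover p zero    = p
mover p (suc k) = mover (other p) k

module _ (G : Graph n) where

  2Δ : ℤ
  2Δ = (+ 2) * (+ maxDegree G)

  prelabelCost : Player → Player → ℤ
  prelabelCost Admirable Admirable = 0ℤ
  prelabelCost Impish    Impish    = 0ℤ
  prelabelCost Admirable Impish    = 2Δ
  prelabelCost Impish    Admirable = 2Δ

  gameValue-cong : ∀ k p {f g} → f ≗ g → gameValue G k p f ≡ gameValue G k p g
  gameValue-cong zero    p f≗g = discrepancy-cong G f≗g
  gameValue-cong (suc k) p {f} {g} f≗g = cong₂ (optimum p) (discrepancy-cong G f≗g) (begin
    map (λ v → gameValue G k (other p) (setLabel f v (labelOf p))) (unlabeled f)
      ≡⟨ map-cong (λ v → gameValue-cong k (other p) (setLabel-cong v (labelOf p) f≗g)) (unlabeled f) ⟩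
    map (λ v → gameValue G k (other p) (setLabel g v (labelOf p))) (unlabeled f)
      ≡⟨ cong (map (λ v → gameValue G k (other p) (setLabel g v (labelOf p))))
              (unlabeled-cong (λ u → cong is-nothing (f≗g u))) ⟩
    map (λ v → gameValue G k (other p) (setLabel g v (labelOf p))) (unlabeled g) ∎)
    where open ≡-Reasoning

  gameValue-flip : ∀ k p {f g} x → (∀ u → u ≢ x → f u ≡ g u) →
    (∀ u → is-nothing (f u) ≡ is-nothing (g u)) → gameValue G k p f ≤ gameValue G k p g + 2Δ
  gameValue-flip zero    p x agree _ = discrepancy-flip G x agree
  gameValue-flip (suc k) p {f} {g} x agree alike rewrite unlabeled-cong alike =
    optimum-map-mono p _ _ (unlabeled g) (discrepancy-flip G x agree)
      (λ {v} _ → gameValue-flip k (other p) x (agree-after v) (alike-after v))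
    where
    agree-after : ∀ v u → u ≢ x → setLabel f v (labelOf p) u ≡ setLabel g v (labelOf p) u
    agree-after v u u≢x with u ≟ v
    ... | yes _ = refl
    ... | no _  = agree u u≢x
    alike-after : ∀ v u → is-nothing (setLabel f v (labelOf p) u) ≡ is-nothing (setLabel g v (labelOf p) u)
    alike-after v u with u ≟ v
    ... | yes _ = refl
    ... | no _  = alike u

  gameValue-last-move : ∀ p {f : Labeling n} {y} → unlabeled f ≡ y ∷ [] →
    gameValue G 1 p f ≡ discrepancy G (setLabel f y (labelOf p))
  gameValue-last-move p last rewrite last = refl

  discrepancy-relabel : ∀ (f : Labeling n) y b c →
    discrepancy G (setLabel f y b) ≤ discrepancy G (setLabel f y c) + 2Δ
  discrepancy-relabel f y b c =
    discrepancy-flip G y (λ u u≢y → trans (setLabel-other f b u≢y) (sym (setLabel-other f c u≢y)))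

  -- When the favoured player would take y he takes another free vertex instead (moves-commute);
  -- a move of the other player is copied, and y stays pre-labelled.
  prelabel-Impish : ∀ k p {f : Labeling n} {y} → length (unlabeled f) ≡ suc k → y ∈ unlabeled f →
    gameValue G (suc k) p f ≤ gameValue G k p (setLabel f y (labelOf Impish)) + prelabelCost Impish (mover p k)
  prelabel-Impish zero Impish count y∈ rewrite gameValue-last-move Impish (length≡1⇒≡[x] count y∈) =
    ℤ.≤-reflexive (sym (ℤ.+-identityʳ _))
  prelabel-Impish zero Admirable {f} {y} count y∈
    rewrite gameValue-last-move Admirable (length≡1⇒≡[x] count y∈) = discrepancy-relabel f y false true
  prelabel-Impish (suc k) Impish {f} {y} count y∈ =
    optimum-Impish-map-≤ {d = discrepancy G f} {d′ = discrepancy G f′} _ _ y∈ answer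
    where
    f′ = setLabel f y true
    cost = prelabelCost Impish (mover Admirable k)
    answer : ∀ {z} → z ∈ unlabeled f → ∃[ z′ ] z′ ∈ unlabeled f′ ×
      gameValue G (suc k) Admirable (setLabel f z true) ≤ gameValue G k Admirable (setLabel f′ z′ true) + cost
    answer {z} z∈ with moves-commute true count y∈ z∈
    ... | y′ , z′ , y′∈ , z′∈ , commute = z′ , z′∈ , (begin
      gameValue G (suc k) Admirable (setLabel f z true)
        ≤⟨ prelabel-Impish k Admirable (length-unlabeled-setLabel true count z∈) y′∈ ⟩
      gameValue G k Admirable (setLabel (setLabel f z true) y′ true) + cost
        ≡⟨ cong (_+ cost) (gameValue-cong k Admirable commute) ⟩
      gameValue G k Admirable (setLabel f′ z′ true) + cost ∎)
      where open ℤ.≤-Reasoning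
  prelabel-Impish (suc k) Admirable {f} {y} count y∈ =
    optimum-Admirable-map-≤ {d = discrepancy G f} {d′ = discrepancy G f′} _ _
      (proj₂ (length≡suc⇒∃∈ count′)) answer
    where
    f′ = setLabel f y true
    count′ = length-unlabeled-setLabel true count y∈
    cost = prelabelCost Impish (mover Impish k)
    answer : ∀ {u} → u ∈ unlabeled f′ → ∃[ z ] z ∈ unlabeled f ×
      gameValue G (suc k) Impish (setLabel f z false) ≤ gameValue G k Impish (setLabel f′ u false) + cost
    answer {u} u∈ with ∈-unlabeled-setLabel⁻ u∈
    ... | u≢y , u∈f = u , u∈f , (begin
      gameValue G (suc k) Impish (setLabel f u false)
        ≤⟨ prelabel-Impish k Impish (length-unlabeled-setLabel false count u∈f)
                                    (∈-unlabeled-setLabel⁺ false (u≢y ∘ sym) y∈) ⟩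
      gameValue G k Impish (setLabel (setLabel f u false) y true) + cost
        ≡⟨ cong (_+ cost) (gameValue-cong k Impish (setLabel-comm f false true u≢y)) ⟩
      gameValue G k Impish (setLabel f′ u false) + cost ∎)
      where open ℤ.≤-Reasoning

  prelabel-Admirable : ∀ k p {f : Labeling n} {y} → length (unlabeled f) ≡ suc k → y ∈ unlabeled f →
    gameValue G k p (setLabel f y (labelOf Admirable)) ≤ gameValue G (suc k) p f + prelabelCost Admirable (mover p k)
  prelabel-Admirable zero Admirable count y∈ rewrite gameValue-last-move Admirable (length≡1⇒≡[x] count y∈) =
    ℤ.≤-reflexive (sym (ℤ.+-identityʳ _))
  prelabel-Admirable zero Impish {f} {y} count y∈
    rewrite gameValue-last-move Impish (length≡1⇒≡[x] count y∈) = discrepancy-relabel f y false true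
  prelabel-Admirable (suc k) Admirable {f} {y} count y∈ =
    optimum-Admirable-map-≤ {d = discrepancy G f′} {d′ = discrepancy G f} _ _ y∈ answer
    where
    f′ = setLabel f y false
    cost = prelabelCost Admirable (mover Impish k)
    answer : ∀ {z} → z ∈ unlabeled f → ∃[ z′ ] z′ ∈ unlabeled f′ ×
      gameValue G k Impish (setLabel f′ z′ false) ≤ gameValue G (suc k) Impish (setLabel f z false) + cost
    answer {z} z∈ with moves-commute false count y∈ z∈
    ... | y′ , z′ , y′∈ , z′∈ , commute = z′ , z′∈ , (begin
      gameValue G k Impish (setLabel f′ z′ false)
        ≡⟨ gameValue-cong k Impish commute ⟨
      gameValue G k Impish (setLabel (setLabel f z false) y′ false)
        ≤⟨ prelabel-Admirable k Impish (length-unlabeled-setLabel false count z∈) y′∈ ⟩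
      gameValue G (suc k) Impish (setLabel f z false) + cost ∎)
      where open ℤ.≤-Reasoning
  prelabel-Admirable (suc k) Impish {f} {y} count y∈ =
    optimum-Impish-map-≤ {d = discrepancy G f′} {d′ = discrepancy G f} _ _
      (proj₂ (length≡suc⇒∃∈ count′)) answer
    where
    f′ = setLabel f y false
    count′ = length-unlabeled-setLabel false count y∈
    cost = prelabelCost Admirable (mover Admirable k)
    answer : ∀ {u} → u ∈ unlabeled f′ → ∃[ z ] z ∈ unlabeled f ×
      gameValue G k Admirable (setLabel f′ u true) ≤ gameValue G (suc k) Admirable (setLabel f z true) + cost
    answer {u} u∈ with ∈-unlabeled-setLabel⁻ u∈
    ... | u≢y , u∈f = u , u∈f , (begin
      gameValue G k Admirable (setLabel f′ u true)
        ≡⟨ gameValue-cong k Admirable (setLabel-comm f true false u≢y) ⟨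
      gameValue G k Admirable (setLabel (setLabel f u true) y false)
        ≤⟨ prelabel-Admirable k Admirable (length-unlabeled-setLabel true count u∈f)
                                          (∈-unlabeled-setLabel⁺ true (u≢y ∘ sym) y∈) ⟩
      gameValue G (suc k) Admirable (setLabel f u true) + cost ∎)
      where open ℤ.≤-Reasoning

module _ {m} (G : Graph (suc m)) where

  private
    ∅ : Labeling (suc m)
    ∅ = emptyLabeling

    count : length (unlabeled ∅) ≡ suc m
    count = trans (cong length (unlabeled-empty {suc m})) (length-tabulate (λ v → v))

    free : ∀ {v} → v ∈ unlabeled ∅
    free = ∈-unlabeled⁺ refl

  bgA≤bgI+cost : bgA G ≤ bgI G + prelabelCost G Impish (mover Admirable m)
  bgA≤bgI+cost = begin
    bgA G
      ≤⟨ prelabel-Impish G m Admirable count (free {zero}) ⟩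
    gameValue G m Admirable (setLabel ∅ zero true) + cost
      ≤⟨ ℤ.+-monoˡ-≤ cost (≤-optimum-Impish {d = discrepancy G ∅} (∈-map⁺ first-move free)) ⟩
    bgI G + cost ∎
    where
    open ℤ.≤-Reasoning
    cost = prelabelCost G Impish (mover Admirable m)
    first-move : Fin (suc m) → ℤ
    first-move v = gameValue G m Admirable (setLabel ∅ v true)

  bgI≤bgA+cost : bgI G ≤ bgA G + prelabelCost G Admirable (mover Admirable m) + 2Δ G
  bgI≤bgA+cost = optimum-Impish-map-lub {d = discrepancy G ∅} _ (free {zero}) bound
    where
    open ℤ.≤-Reasoning
    cost = prelabelCost G Admirable (mover Admirable m)
    bound : ∀ {z} → z ∈ unlabeled ∅ → gameValue G m Admirable (setLabel ∅ z true) ≤ bgA G + cost + 2Δ G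
    bound {z} z∈ = begin
      gameValue G m Admirable (setLabel ∅ z true)
        ≤⟨ gameValue-flip G m Admirable z agree alike ⟩
      gameValue G m Admirable (setLabel ∅ z false) + 2Δ G
        ≤⟨ ℤ.+-monoˡ-≤ (2Δ G) (prelabel-Admirable G m Admirable count z∈) ⟩
      bgA G + cost + 2Δ G ∎
      where
      agree : ∀ u → u ≢ z → setLabel ∅ z true u ≡ setLabel ∅ z false u
      agree u u≢z = trans (setLabel-other ∅ true u≢z) (sym (setLabel-other ∅ false u≢z))
      alike : ∀ u → is-nothing (setLabel ∅ z true u) ≡ is-nothing (setLabel ∅ z false u)
      alike u with u ≟ z
      ... | yes _ = refl
      ... | no _  = refl

mover-even : ∀ m → suc m % 2 ≡ 0 → mover Admirable m ≡ Impish
mover-even (suc zero)    _    = refl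
mover-even (suc (suc m)) even = mover-even m even

mover-odd : ∀ m → suc m % 2 ≡ 1 → mover Admirable m ≡ Admirable
mover-odd zero          _   = refl
mover-odd (suc (suc m)) odd = mover-odd m odd

i≤j+k⇒i-k≤j : ∀ {i j} k → i ≤ j + k → i - k ≤ j
i≤j+k⇒i-k≤j {i} {j} k i≤j+k = begin
  i - k       ≤⟨ ℤ.+-monoˡ-≤ (- k) i≤j+k ⟩
  j + k - k   ≡⟨ ℤ.+-assoc j k (- k) ⟩
  j + (k - k) ≡⟨ cong (λ t → j + t) (ℤ.+-inverseʳ k) ⟩
  j + 0ℤ      ≡⟨ ℤ.+-identityʳ j ⟩
  j           ∎
  where open ℤ.≤-Reasoning

proposition2p3 : (n : ℕ) (G : Graph n) →
    ((n % 2 ≡ 0) → (bgA G ≤ bgI G) × (bgI G ≤ bgA G + (+ 4) * (+ maxDegree G)))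
    × ((n % 2 ≡ 1) → (bgA G - (+ 2) * (+ maxDegree G) ≤ bgI G) × (bgI G ≤ bgA G + (+ 2) * (+ maxDegree G)))
proposition2p3 zero G = (λ _ → ℤ.≤-refl , ≤+4Δ) , λ ()
  where
  ≤+4Δ : bgA G ≤ bgA G + (+ 4) * (+ maxDegree G)
  ≤+4Δ = ℤ.≤-trans (ℤ.i≤i+j (bgA G) (+ (4 ℕ.* maxDegree G)))
                   (ℤ.≤-reflexive (cong (λ t → bgA G + t) (ℤ.pos-* 4 (maxDegree G))))
proposition2p3 (suc m) G
  with mover Admirable m | mover-even m | mover-odd m | bgA≤bgI+cost G | bgI≤bgA+cost G
... | Impish    | _      | odd⇒A | lower | upper =
  (λ _ → ℤ.≤-trans lower (ℤ.≤-reflexive (ℤ.+-identityʳ (bgI G)))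
       , ℤ.≤-trans upper (ℤ.≤-reflexive twice))
  , λ odd → case odd⇒A odd of λ ()
  where
  twice : bgA G + 2Δ G + 2Δ G ≡ bgA G + (+ 4) * (+ maxDegree G)
  twice = trans (ℤ.+-assoc (bgA G) (2Δ G) (2Δ G))
                (cong (λ t → bgA G + t) (sym (ℤ.*-distribʳ-+ (+ maxDegree G) (+ 2) (+ 2))))
... | Admirable | even⇒I | _    | lower | upper =
  (λ even → case even⇒I even of λ ())
  , λ _ → i≤j+k⇒i-k≤j (2Δ G) lower
        , ℤ.≤-trans upper (ℤ.≤-reflexive (cong (_+ 2Δ G) (ℤ.+-identityʳ (bgA G))))
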